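{- Let $r\ge 0$ be an integer, let $d_0,\dots,d_r$ and $c_1,\dots,c_r$ be integers, and let $(S(n))_{n\ge 0}$ be defined by $S(0)=1$, $S(i)=c_i$ for $1\le i\le r$, and $S(n+1)=d_0S(n)+d_1S(n-1)+\cdots+d_rS(n-r)$ for all $n\ge r$. Define $v=\begin{bmatrix}1&0&\cdots&0\end{bmatrix}\in\mathbb{Z}^{1\times(r+1)}$, $w=\begin{bmatrix}1& c_1& \cdots& c_r\end{bmatrix}^{T}$, let $\gamma(0)$ be the $(r+1)\times(r+1)$ integer matrix whose first column is $w$ and whose other columns are zero, and let $\gamma(1)$ be the $(r+1)\times(r+1)$ integer matrix whose first $r$ rows are $\begin{bmatrix}0 & I_{r}\end{bmatrix}$ and whose last row is $\begin{bmatrix}d_r & d_{r-1} & \cdots & d_0\end{bmatrix}$. Let $(T(n))_{n\ge0}$ be the run length transform of $(S(n))_{n\ge 0}$. Then $T(n)=v\,\gamma([n]_2)\,w$ for all $n\ge 0$; in particular $(T(n))_{n\ge 0}$ is a $2$-regular sequence.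
   Context: For $n\ge 0$, $[n]_2$ denotes the binary representation of $n$ (most significant digit first; $[0]_2$ is the empty word). For a binary word $x=x_m x_{m-1}\cdots x_1$, $\gamma(x)=\gamma(x_m)\gamma(x_{m-1})\cdots\gamma(x_1)$, with $\gamma(\text{empty word})$ the identity. The run length transform of a sequence $(S(n))_{n\ge0}$ is the sequence $T(n)=\prod_{i\in\mathcal{L}(n)}S(i)$, where $\mathcal{L}(n)$ is the multiset of lengths of all maximal runs of $1$'s in $[n]_2$ (so $T(0)=1$ as an empty product; e.g. $T(11)=S(1)S(2)$ since $[11]_2=1011$). A sequence $a$ is $2$-regular if there exist $d\ge1$, a row vector $v\in\mathbb{Z}^{1\times d}$, a column vector $w\in\mathbb{Z}^{d\times1}$ and matrices $\gamma(0),\gamma(1)\in\mathbb{Z}^{d\times d}$ with $a(n)=v\gamma([n]_2)w$ for all $n\ge0$. -}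

module Defs where

open import Data.Nat as ℕ using (ℕ; zero; suc; _∸_; _/_; _%_)
open import Data.Bool using (Bool; true; false; if_then_else_)
open import Data.List using (List; []; _∷_; _++_; map; reverse; foldr)
open import Data.Fin using (Fin; zero; suc; toℕ; opposite)
open import Data.Integer using (ℤ; +_; _+_; _*_; 1ℤ; 0ℤ)
open import Data.Product using (Σ; _×_)
open import Relation.Binary.PropositionalEquality using (_≡_)
open import Relation.Nullary.Decidable using (⌊_⌋)

∑ : ∀ {n} → (Fin n → ℤ) → ℤ
∑ {zero}  f = 0ℤ
∑ {suc n} f = f zero + ∑ (λ i → f (suc i))

Mat : ℕ → ℕ → Set
Mat m n = Fin m → Fin n → ℤ

_⊗_ : ∀ {m k n} → Mat m k → Mat k n → Mat m n
(A ⊗ B) i j = ∑ (λ l → A i l * B l j)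

idM : ∀ {n} → Mat n n
idM i j = if ⌊ toℕ i ℕ.≟ toℕ j ⌋ then 1ℤ else 0ℤ

-- Binary digits, least significant first (fuel-based; fuel n suffices)
bitsLSB : ℕ → ℕ → List Bool
bitsLSB zero     n = []
bitsLSB (suc f) n = if ⌊ n ℕ.≟ 0 ⌋ then []
                    else ⌊ n % 2 ℕ.≟ 1 ⌋ ∷ bitsLSB f (n / 2)

-- [n]_2 : binary representation, most significant digit first; [0]_2 = []
bin : ℕ → List Bool
bin n = reverse (bitsLSB n n)

-- γ(x) = γ(x_m) ⋯ γ(x_1), γ(empty) = identity
γword : ∀ {d} → Mat d d → Mat d d → List Bool → Mat d d
γword γ0 γ1 []            = idM
γword γ0 γ1 (false ∷ bs) = γ0 ⊗ γword γ0 γ1 bs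
γword γ0 γ1 (true ∷ bs)  = γ1 ⊗ γword γ0 γ1 bs

-- lengths of the maximal runs of 1's in a binary word (with current run length k)
flush : ℕ → List ℕ
flush zero    = []
flush (suc k) = suc k ∷ []

runsAux : ℕ → List Bool → List ℕ
runsAux k []            = flush k
runsAux k (true ∷ bs)  = runsAux (suc k) bs
runsAux k (false ∷ bs) = flush k ++ runsAux 0 bs

runLengths : ℕ → List ℕ
runLengths n = runsAux 0 (bin n)

RLT : (ℕ → ℤ) → ℕ → ℤ
RLT S n = foldr _*_ 1ℤ (map S (runLengths n))

IsTwoRegular : (ℕ → ℤ) → Set
IsTwoRegular a =
  Σ ℕ λ d → (1 ℕ.≤ d) × Σ (Mat 1 d) λ v → Σ (Mat d 1) λ w →
  Σ (Mat d d) λ γ0 → Σ (Mat d d) λ γ1 →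
  ∀ n → a n ≡ (v ⊗ (γword γ0 γ1 (bin n) ⊗ w)) zero zero

-- The specific data of the theorem (r, d_0..d_r as d : Fin (suc r) → ℤ,
-- c_1..c_r as c : Fin r → ℤ with c i = c_{i+1})
vVec : ∀ r → Mat 1 (suc r)
vVec r _ zero    = 1ℤ
vVec r _ (suc _) = 0ℤ

wVec : ∀ r → (Fin r → ℤ) → Mat (suc r) 1
wVec r c zero    _ = 1ℤ
wVec r c (suc i) _ = c i

γ₀ : ∀ r → (Fin r → ℤ) → Mat (suc r) (suc r)
γ₀ r c i zero    = wVec r c i zero
γ₀ r c i (suc _) = 0ℤ

-- first r rows [0 | I_r]; last row [d_r d_{r-1} ... d_0]
γ₁ : ∀ r → (Fin (suc r) → ℤ) → Mat (suc r) (suc r)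
γ₁ r d i j = if ⌊ toℕ i ℕ.<? r ⌋
             then (if ⌊ toℕ j ℕ.≟ suc (toℕ i) ⌋ then 1ℤ else 0ℤ)
             else d (opposite j)

{-# OPTIONS --safe #-}
module Submission where

-- For a binary word x whose leading run has ℓ ones, let Tₓ(k) = S(k + ℓ)·P(x), where P(x)
-- is the product of S over the remaining runs; Tₓ(k) is the run-length product of 1ᵏx.
-- By induction on x, γ(x)w is the window (Tₓ(0), …, Tₓ(r)). Every Tₓ is a shifted multiple
-- of S and so satisfies the recurrence; hence the companion matrix γ(1) shifts the window,
-- matching T₁ₓ(k) = Tₓ(k+1), while γ(0) replaces it by Tₓ(0)·w, the window of
-- T₀ₓ(k) = S(k)·Tₓ(0). The first entry of γ([n]₂)w is then T_{[n]₂}(0) = T(n).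

open import Defs
open import Data.Nat
  using (ℕ; zero; suc; _∸_; _≤_; _<_; _≟_; _<?_; _≡ᵇ_; z≤n; s≤s; s≤s⁻¹)
import Data.Nat as ℕ
import Data.Nat.Properties as ℕ
open import Data.Fin using (Fin; zero; suc; toℕ; opposite)
open import Data.Fin.Permutation using (reverse)
open import Data.Fin.Properties using (toℕ<n; opposite-prop; opposite-involutive)
open import Data.Integer using (ℤ; _*_; _+_; 1ℤ; 0ℤ)
open import Data.Integer.Properties
  using (*-assoc; *-identityˡ; *-identityʳ; +-identityˡ; +-identityʳ; +-*-semiring)
open import Algebra.Properties.Semiring.Sum +-*-semiring
  using (sum; sum-cong-≗; sum-replicate-zero; ∑-comm; ∑-permute; *-distribˡ-sum; *-distribʳ-sum)
open import Data.Bool using (Bool; true; false; if_then_else_)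
open import Data.List using (List; []; _∷_; _++_; map; foldr)
open import Data.List.Properties using (++-identityʳ)
open import Data.Product using (_×_; _,_)
open import Function using (_∘_)
open import Relation.Binary.PropositionalEquality
open import Relation.Nullary using (Dec; yes; no)
open import Relation.Nullary.Decidable using (⌊_⌋; isYes≗does)

open ≡-Reasoning

∑≗sum : ∀ {n} (f : Fin n → ℤ) → ∑ f ≡ sum f
∑≗sum {zero}  f = refl
∑≗sum {suc n} f = cong (f zero +_) (∑≗sum (f ∘ suc))

∑-cong : ∀ {n} {f g : Fin n → ℤ} → f ≗ g → ∑ f ≡ ∑ g
∑-cong {f = f} {g} f≗g = begin
  ∑ f   ≡⟨ ∑≗sum f ⟩
  sum f ≡⟨ sum-cong-≗ f≗g ⟩
  sum g ≡⟨ ∑≗sum g ⟨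
  ∑ g   ∎

∑-zero : ∀ n → ∑ {n} (λ _ → 0ℤ) ≡ 0ℤ
∑-zero n = trans (∑≗sum {n} (λ _ → 0ℤ)) (sum-replicate-zero n)

∑-*ˡ : ∀ {n} a (f : Fin n → ℤ) → a * ∑ f ≡ ∑ (λ i → a * f i)
∑-*ˡ a f = begin
  a * ∑ f               ≡⟨ cong (a *_) (∑≗sum f) ⟩
  a * sum f             ≡⟨ *-distribˡ-sum a f ⟩
  sum (λ i → a * f i)   ≡⟨ ∑≗sum (λ i → a * f i) ⟨
  ∑ (λ i → a * f i)     ∎

∑-*ʳ : ∀ {n} a (f : Fin n → ℤ) → ∑ f * a ≡ ∑ (λ i → f i * a)
∑-*ʳ a f = begin
  ∑ f * a               ≡⟨ cong (_* a) (∑≗sum f) ⟩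
  sum f * a             ≡⟨ *-distribʳ-sum a f ⟩
  sum (λ i → f i * a)   ≡⟨ ∑≗sum (λ i → f i * a) ⟨
  ∑ (λ i → f i * a)     ∎

∑-swap : ∀ {m n} (f : Fin m → Fin n → ℤ) →
         ∑ (λ i → ∑ (λ j → f i j)) ≡ ∑ (λ j → ∑ (λ i → f i j))
∑-swap f = begin
  ∑ (λ i → ∑ (λ j → f i j))       ≡⟨ ∑-cong (λ i → ∑≗sum (f i)) ⟩
  ∑ (λ i → sum (λ j → f i j))     ≡⟨ ∑≗sum (λ i → sum (λ j → f i j)) ⟩
  sum (λ i → sum (λ j → f i j))   ≡⟨ ∑-comm f ⟩
  sum (λ j → sum (λ i → f i j))   ≡⟨ ∑≗sum (λ j → sum (λ i → f i j)) ⟨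
  ∑ (λ j → sum (λ i → f i j))     ≡⟨ ∑-cong (λ j → ∑≗sum (λ i → f i j)) ⟨
  ∑ (λ j → ∑ (λ i → f i j))       ∎

∑-reverse : ∀ {n} (f : Fin n → ℤ) → ∑ f ≡ ∑ (f ∘ opposite)
∑-reverse f = begin
  ∑ f                ≡⟨ ∑≗sum f ⟩
  sum f              ≡⟨ ∑-permute f reverse ⟩
  sum (f ∘ opposite) ≡⟨ ∑≗sum (f ∘ opposite) ⟨
  ∑ (f ∘ opposite)   ∎

-- Unlike ⌊ m ≟ n ⌋, the test m ≡ᵇ n reduces when m and n are both successors.
δ : ℕ → ℕ → ℤ
δ m n = if m ≡ᵇ n then 1ℤ else 0ℤ

if-≟≡δ : ∀ m n → (if ⌊ m ≟ n ⌋ then 1ℤ else 0ℤ) ≡ δ m n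
if-≟≡δ m n = cong (λ b → if b then 1ℤ else 0ℤ) (isYes≗does (m ≟ n))

δ-comm : ∀ m n → δ m n ≡ δ n m
δ-comm zero    zero    = refl
δ-comm zero    (suc n) = refl
δ-comm (suc m) zero    = refl
δ-comm (suc m) (suc n) = δ-comm m n

∑-select : ∀ {n} (f : ℕ → ℤ) {m} → m < n →
           ∑ (λ (l : Fin n) → δ m (toℕ l) * f (toℕ l)) ≡ f m
∑-select {suc n} f {zero} _ = begin
  1ℤ * f 0 + ∑ {n} (λ _ → 0ℤ) ≡⟨ cong₂ _+_ (*-identityˡ (f 0)) (∑-zero n) ⟩
  f 0 + 0ℤ                    ≡⟨ +-identityʳ (f 0) ⟩
  f 0                         ∎
∑-select {suc n} f {suc m} m<n =
  trans (+-identityˡ _) (∑-select (f ∘ suc) (s≤s⁻¹ m<n))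

infix 4 _≋_
_≋_ : ∀ {m n} → Mat m n → Mat m n → Set
A ≋ B = ∀ i j → A i j ≡ B i j

⊗-assoc : ∀ {a b c e} (A : Mat a b) (B : Mat b c) (C : Mat c e) →
          (A ⊗ B) ⊗ C ≋ A ⊗ (B ⊗ C)
⊗-assoc A B C i j = begin
  ∑ (λ l → ∑ (λ m → A i m * B m l) * C l j)
    ≡⟨ ∑-cong (λ l → ∑-*ʳ (C l j) (λ m → A i m * B m l)) ⟩
  ∑ (λ l → ∑ (λ m → A i m * B m l * C l j))
    ≡⟨ ∑-swap (λ l m → A i m * B m l * C l j) ⟩
  ∑ (λ m → ∑ (λ l → A i m * B m l * C l j))
    ≡⟨ ∑-cong (λ m → ∑-cong (λ l → *-assoc (A i m) (B m l) (C l j))) ⟩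
  ∑ (λ m → ∑ (λ l → A i m * (B m l * C l j)))
    ≡⟨ ∑-cong (λ m → ∑-*ˡ (A i m) (λ l → B m l * C l j)) ⟨
  ∑ (λ m → A i m * ∑ (λ l → B m l * C l j))
    ∎

⊗-congˡ : ∀ {m k n} (A : Mat m k) {X Y : Mat k n} → X ≋ Y → A ⊗ X ≋ A ⊗ Y
⊗-congˡ A X≋Y i j = ∑-cong (λ l → cong (A i l *_) (X≋Y l j))

⊗-firstColumn : ∀ {m k n} (A : Mat m (suc k)) (X : Mat (suc k) n) →
                (∀ i l → A i (suc l) ≡ 0ℤ) → ∀ i j → (A ⊗ X) i j ≡ A i zero * X zero j
⊗-firstColumn {k = k} A X A≡0 i j = begin
  A i zero * X zero j + ∑ (λ l → A i (suc l) * X (suc l) j)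
    ≡⟨ cong (A i zero * X zero j +_) (∑-cong (λ l → cong (_* X (suc l) j) (A≡0 i l))) ⟩
  A i zero * X zero j + ∑ {k} (λ _ → 0ℤ) ≡⟨ cong (A i zero * X zero j +_) (∑-zero k) ⟩
  A i zero * X zero j + 0ℤ               ≡⟨ +-identityʳ _ ⟩
  A i zero * X zero j                    ∎

column : ∀ {m} → (ℕ → ℤ) → Mat m 1
column f i _ = f (toℕ i)

⊗-identityˡ-column : ∀ {m} (f : ℕ → ℤ) → idM {m} ⊗ column f ≋ column f
⊗-identityˡ-column {m} f i _ = begin
  ∑ (λ l → idM i l * f (toℕ l))
    ≡⟨ ∑-cong {m} (λ l → cong (_* f (toℕ l)) (if-≟≡δ (toℕ i) (toℕ l))) ⟩
  ∑ (λ (l : Fin m) → δ (toℕ i) (toℕ l) * f (toℕ l))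
    ≡⟨ ∑-select f (toℕ<n i) ⟩
  f (toℕ i)
    ∎

SatisfiesRecurrence : ∀ r → (Fin (suc r) → ℤ) → (ℕ → ℤ) → Set
SatisfiesRecurrence r d f =
  ∀ n → r ≤ n → f (suc n) ≡ ∑ (λ (j : Fin (suc r)) → d j * f (n ∸ toℕ j))

module _ {r} {d : Fin (suc r) → ℤ} {f : ℕ → ℤ} (rec : SatisfiesRecurrence r d f) where

  recurrence-shift : ∀ k → SatisfiesRecurrence r d (λ m → f (m ℕ.+ k))
  recurrence-shift k n r≤n = begin
    f (suc (n ℕ.+ k))
      ≡⟨ rec (n ℕ.+ k) (ℕ.≤-trans r≤n (ℕ.m≤m+n n k)) ⟩
    ∑ (λ j → d j * f (n ℕ.+ k ∸ toℕ j))
      ≡⟨ ∑-cong (λ j → cong (λ x → d j * f x) (ℕ.+-∸-comm k (j≤n j))) ⟩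
    ∑ (λ j → d j * f ((n ∸ toℕ j) ℕ.+ k))
      ∎
    where
    j≤n : (j : Fin (suc r)) → toℕ j ≤ n
    j≤n j = ℕ.≤-trans (s≤s⁻¹ (toℕ<n j)) r≤n

  recurrence-scale : ∀ a → SatisfiesRecurrence r d (λ m → f m * a)
  recurrence-scale a n r≤n = begin
    f (suc n) * a                       ≡⟨ cong (_* a) (rec n r≤n) ⟩
    ∑ (λ j → d j * f (n ∸ toℕ j)) * a   ≡⟨ ∑-*ʳ a (λ j → d j * f (n ∸ toℕ j)) ⟩
    ∑ (λ j → d j * f (n ∸ toℕ j) * a)   ≡⟨ ∑-cong (λ j → *-assoc (d j) (f (n ∸ toℕ j)) a) ⟩
    ∑ (λ j → d j * (f (n ∸ toℕ j) * a)) ∎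

γ₁-row : ∀ {r} (d : Fin (suc r) → ℤ) (i l : Fin (suc r)) →
         γ₁ r d i l ≡ (if ⌊ toℕ i <? r ⌋ then δ (suc (toℕ i)) (toℕ l) else d (opposite l))
γ₁-row {r} d i l = cong (λ x → if ⌊ toℕ i <? r ⌋ then x else d (opposite l))
  (trans (if-≟≡δ (toℕ l) (suc (toℕ i))) (δ-comm (toℕ l) (suc (toℕ i))))

γ₁-shift : ∀ {r d f} → SatisfiesRecurrence r d f → γ₁ r d ⊗ column f ≋ column (f ∘ suc)
γ₁-shift {r} {d} {f} rec i _ =
  trans (∑-cong (λ l → cong (_* f (toℕ l)) (γ₁-row d i l))) (row (toℕ i <? r))
  where
  row : (i<r? : Dec (toℕ i < r)) →
        ∑ (λ l → (if ⌊ i<r? ⌋ then δ (suc (toℕ i)) (toℕ l) else d (opposite l)) * f (toℕ l))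
        ≡ f (suc (toℕ i))
  row (yes i<r) = ∑-select f (s≤s i<r)
  row (no i≮r) = begin
    ∑ (λ l → d (opposite l) * f (toℕ l))
      ≡⟨ ∑-reverse (λ l → d (opposite l) * f (toℕ l)) ⟩
    ∑ (λ j → d (opposite (opposite j)) * f (toℕ (opposite j)))
      ≡⟨ ∑-cong (λ j → cong₂ (λ a b → d a * f b) (opposite-involutive j) (opposite-prop j)) ⟩
    ∑ (λ j → d j * f (r ∸ toℕ j))
      ≡⟨ rec r ℕ.≤-refl ⟨
    f (suc r)
      ≡⟨ cong (f ∘ suc) (ℕ.≤∧≮⇒≡ (s≤s⁻¹ (toℕ<n i)) i≮r) ⟨
    f (suc (toℕ i)) ∎

leadingOnes : List Bool → ℕ
leadingOnes (true ∷ bs) = suc (leadingOnes bs)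
leadingOnes _           = 0

module _ (S : ℕ → ℤ) where

  ∏S : List ℕ → ℤ
  ∏S xs = foldr _*_ 1ℤ (map S xs)

  laterRunsProduct : List Bool → ℤ
  laterRunsProduct []           = 1ℤ
  laterRunsProduct (true ∷ bs)  = laterRunsProduct bs
  laterRunsProduct (false ∷ bs) = S (leadingOnes bs) * laterRunsProduct bs

  prefixedRunProduct : List Bool → ℕ → ℤ
  prefixedRunProduct bs k = S (k ℕ.+ leadingOnes bs) * laterRunsProduct bs

prefixedRunProduct-recurrence : ∀ {r d S} → SatisfiesRecurrence r d S →
                                ∀ bs → SatisfiesRecurrence r d (prefixedRunProduct S bs)
prefixedRunProduct-recurrence {d = d} {S} rec bs =
  recurrence-scale {d = d} {f = λ m → S (m ℕ.+ leadingOnes bs)}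
    (recurrence-shift {d = d} {f = S} rec (leadingOnes bs)) (laterRunsProduct S bs)

module _ {S : ℕ → ℤ} (S₀ : S 0 ≡ 1ℤ) where

  ∏S-flush-++ : ∀ k xs → ∏S S (flush k ++ xs) ≡ S k * ∏S S xs
  ∏S-flush-++ zero    xs = begin
    ∏S S xs        ≡⟨ *-identityˡ (∏S S xs) ⟨
    1ℤ * ∏S S xs   ≡⟨ cong (_* ∏S S xs) S₀ ⟨
    S 0 * ∏S S xs  ∎
  ∏S-flush-++ (suc k) xs = refl

  ∏S-runsAux : ∀ k bs → ∏S S (runsAux k bs) ≡ prefixedRunProduct S bs k
  ∏S-runsAux k [] = begin
    ∏S S (flush k)        ≡⟨ cong (∏S S) (++-identityʳ (flush k)) ⟨
    ∏S S (flush k ++ [])  ≡⟨ ∏S-flush-++ k [] ⟩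
    S k * 1ℤ              ≡⟨ cong (λ x → S x * 1ℤ) (ℕ.+-identityʳ k) ⟨
    S (k ℕ.+ 0) * 1ℤ      ∎
  ∏S-runsAux k (true ∷ bs) = begin
    ∏S S (runsAux (suc k) bs)
      ≡⟨ ∏S-runsAux (suc k) bs ⟩
    S (suc k ℕ.+ leadingOnes bs) * laterRunsProduct S bs
      ≡⟨ cong (λ x → S x * laterRunsProduct S bs) (ℕ.+-suc k (leadingOnes bs)) ⟨
    S (k ℕ.+ suc (leadingOnes bs)) * laterRunsProduct S bs
      ∎
  ∏S-runsAux k (false ∷ bs) = begin
    ∏S S (flush k ++ runsAux 0 bs)
      ≡⟨ ∏S-flush-++ k (runsAux 0 bs) ⟩
    S k * ∏S S (runsAux 0 bs)
      ≡⟨ cong (S k *_) (∏S-runsAux 0 bs) ⟩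
    S k * laterRunsProduct S (false ∷ bs)
      ≡⟨ cong (λ x → S x * laterRunsProduct S (false ∷ bs)) (ℕ.+-identityʳ k) ⟨
    S (k ℕ.+ 0) * laterRunsProduct S (false ∷ bs)
      ∎

module _ {r} (d : Fin (suc r) → ℤ) (c : Fin r → ℤ) {S : ℕ → ℤ} (S₀ : S 0 ≡ 1ℤ)
         (S-init : ∀ i → S (suc (toℕ i)) ≡ c i) (rec : SatisfiesRecurrence r d S) where

  wVec≋column : wVec r c ≋ column S
  wVec≋column zero    _ = sym S₀
  wVec≋column (suc i) _ = sym (S-init i)

  γword-⊗-wVec : ∀ bs → γword (γ₀ r c) (γ₁ r d) bs ⊗ wVec r c ≋
                        column (prefixedRunProduct S bs)
  γword-⊗-wVec [] i j = begin
    (idM ⊗ wVec r c) i j              ≡⟨ ⊗-congˡ idM wVec≋column i j ⟩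
    (idM ⊗ column S) i j              ≡⟨ ⊗-identityˡ-column S i j ⟩
    S (toℕ i)                         ≡⟨ *-identityʳ (S (toℕ i)) ⟨
    S (toℕ i) * 1ℤ                    ≡⟨ cong (λ x → S x * 1ℤ) (ℕ.+-identityʳ (toℕ i)) ⟨
    prefixedRunProduct S [] (toℕ i)   ∎
  γword-⊗-wVec (true ∷ bs) i j = begin
    ((γ₁ r d ⊗ W) ⊗ wVec r c) i j
      ≡⟨ ⊗-assoc (γ₁ r d) W (wVec r c) i j ⟩
    (γ₁ r d ⊗ (W ⊗ wVec r c)) i j
      ≡⟨ ⊗-congˡ (γ₁ r d) (γword-⊗-wVec bs) i j ⟩
    (γ₁ r d ⊗ column (prefixedRunProduct S bs)) i j
      ≡⟨ γ₁-shift {d = d} (prefixedRunProduct-recurrence {d = d} rec bs) i j ⟩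
    prefixedRunProduct S bs (suc (toℕ i))
      ≡⟨ cong (λ x → S x * laterRunsProduct S bs) (ℕ.+-suc (toℕ i) (leadingOnes bs)) ⟨
    prefixedRunProduct S (true ∷ bs) (toℕ i)
      ∎
    where
    W : Mat (suc r) (suc r)
    W = γword (γ₀ r c) (γ₁ r d) bs
  γword-⊗-wVec (false ∷ bs) i j = begin
    ((γ₀ r c ⊗ W) ⊗ wVec r c) i j
      ≡⟨ ⊗-assoc (γ₀ r c) W (wVec r c) i j ⟩
    (γ₀ r c ⊗ (W ⊗ wVec r c)) i j
      ≡⟨ ⊗-firstColumn (γ₀ r c) (W ⊗ wVec r c) (λ _ _ → refl) i j ⟩
    wVec r c i zero * (W ⊗ wVec r c) zero j
      ≡⟨ cong₂ _*_ (wVec≋column i j) (γword-⊗-wVec bs zero j) ⟩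
    S (toℕ i) * prefixedRunProduct S bs 0
      ≡⟨ cong (λ x → S x * prefixedRunProduct S bs 0) (ℕ.+-identityʳ (toℕ i)) ⟨
    prefixedRunProduct S (false ∷ bs) (toℕ i)
      ∎
    where
    W : Mat (suc r) (suc r)
    W = γword (γ₀ r c) (γ₁ r d) bs

theorem1 : (r : ℕ) (d : Fin (suc r) → ℤ) (c : Fin r → ℤ) (S : ℕ → ℤ) →
    S 0 ≡ 1ℤ →
    (∀ (i : Fin r) → S (suc (toℕ i)) ≡ c i) →
    (∀ n → r ≤ n → S (suc n) ≡ ∑ (λ (j : Fin (suc r)) → d j * S (n ∸ toℕ j))) →
    (∀ n → RLT S n ≡ (vVec r ⊗ (γword (γ₀ r c) (γ₁ r d) (bin n) ⊗ wVec r c)) zero zero)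
    × IsTwoRegular (RLT S)
theorem1 r d c S S₀ S-init rec =
  T≡vγw , (suc r , s≤s z≤n , vVec r , wVec r c , γ₀ r c , γ₁ r d , T≡vγw)
  where
  T≡vγw : ∀ n → RLT S n ≡ (vVec r ⊗ (γword (γ₀ r c) (γ₁ r d) (bin n) ⊗ wVec r c)) zero zero
  T≡vγw n = begin
    RLT S n
      ≡⟨ ∏S-runsAux S₀ 0 (bin n) ⟩
    prefixedRunProduct S (bin n) 0
      ≡⟨ γword-⊗-wVec d c S₀ S-init rec (bin n) zero zero ⟨
    (W ⊗ wVec r c) zero zero
      ≡⟨ *-identityˡ _ ⟨
    1ℤ * (W ⊗ wVec r c) zero zero
      ≡⟨ ⊗-firstColumn (vVec r) (W ⊗ wVec r c) (λ _ _ → refl) zero zero ⟨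
    (vVec r ⊗ (W ⊗ wVec r c)) zero zero
      ∎
    where
    W : Mat (suc r) (suc r)
    W = γword (γ₀ r c) (γ₁ r d) (bin n)
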